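{- Let $p\ge5$ be a prime. There are no finite vertex-transitive graphs with motion $p$. More precisely, if $\Gamma$ is a finite vertex-transitive graph whose automorphism group contains a $p$-cycle, then $\Gamma\cong\Theta[\Delta]$, where $\Theta$ is a vertex-transitive graph and $\Delta$ is either $K_m$ or $mK_1$ for some $m\ge2$, or a circulant graph on $p$ vertices.
   Context: Graphs are finite, simple, undirected. The motion of a graph is the minimum number of vertices moved by a non-identity automorphism. For graphs $\Theta,\Delta$, the lexicographic product $\Theta[\Delta]$ has vertex set $V\Delta\times V\Theta$ with $(\delta_1,\theta_1)\sim(\delta_2,\theta_2)$ iff ($\theta_1=\theta_2$ and $\delta_1\sim\delta_2$) or $\theta_1\sim\theta_2$. $K_m$ is complete, $mK_1$ edgeless on $m$ vertices; a circulant graph on $p$ vertices is a graph on $\mathbb Z_p$ invariant under all translations. -}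

module Defs where

open import Data.Nat using (ℕ; zero; suc; _+_; _*_; _≤_)
open import Data.Nat.DivMod using (_mod_)
open import Data.Fin using (Fin; toℕ; remQuot; _≟_)
open import Data.Bool using (Bool; true; false; _∧_; _∨_)
open import Data.Empty using (⊥-elim)
open import Data.List using (List; length; filter; allFin)
open import Data.Product using (Σ; ∃; _×_; _,_; proj₁; proj₂)
open import Relation.Nullary using (¬_; does; yes; no; ¬?)
open import Relation.Binary.PropositionalEquality using (_≡_; _≢_; refl; sym; cong)
open import Function.Bundles using (_↔_; Inverse)

record Graph (n : ℕ) : Set where
  field
    adj    : Fin n → Fin n → Bool
    symm   : ∀ x y → adj x y ≡ adj y x
    irrefl : ∀ x → adj x x ≡ false
open Graph public

record _≅_ {n n′ : ℕ} (Γ : Graph n) (Γ′ : Graph n′) : Set where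
  field
    bij      : Fin n ↔ Fin n′
    preserve : ∀ x y → adj Γ′ (Inverse.to bij x) (Inverse.to bij y) ≡ adj Γ x y

record Aut {n : ℕ} (Γ : Graph n) : Set where
  field
    perm     : Fin n ↔ Fin n
    preserve : ∀ x y → adj Γ (Inverse.to perm x) (Inverse.to perm y) ≡ adj Γ x y

app : ∀ {n} {Γ : Graph n} → Aut Γ → Fin n → Fin n
app σ = Inverse.to (Aut.perm σ)

VertexTransitive : ∀ {n} → Graph n → Set
VertexTransitive {n} Γ = ∀ (x y : Fin n) → Σ (Aut Γ) λ σ → app σ x ≡ y

NonIdentity : ∀ {n} {Γ : Graph n} → Aut Γ → Set
NonIdentity {n} σ = ∃ λ (x : Fin n) → app σ x ≢ x

moved : ∀ {n} {Γ : Graph n} → Aut Γ → ℕ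
moved {n} σ = length (filter (λ x → ¬? (app σ x ≟ x)) (allFin n))

HasMotion : ∀ {n} → Graph n → ℕ → Set
HasMotion Γ k =
  (Σ (Aut Γ) λ σ → NonIdentity σ × moved σ ≡ k)
  × (∀ (σ : Aut Γ) → NonIdentity σ → k ≤ moved σ)

shift : ∀ {m} → Fin m → Fin m → Fin m
shift {suc m} k i = (toℕ i + toℕ k) mod (suc m)

nextMod : ∀ {m} → Fin m → Fin m
nextMod {suc m} i = suc (toℕ i) mod (suc m)

IsCycle : ∀ {n} {Γ : Graph n} → ℕ → Aut Γ → Set
IsCycle {n} p σ =
  Σ (Fin p → Fin n) λ c →
    (∀ i j → c i ≡ c j → i ≡ j)
    × (∀ i → app σ (c i) ≡ c (nextMod i))
    × (∀ y → (∀ i → c i ≢ y) → app σ y ≡ y)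

IsCirculant : ∀ {m} → Graph m → Set
IsCirculant {m} Δ = ∀ (k i j : Fin m) → adj Δ (shift k i) (shift k j) ≡ adj Δ i j

IsComplete : ∀ {m} → Graph m → Set
IsComplete {m} Δ = ∀ (i j : Fin m) → i ≢ j → adj Δ i j ≡ true

IsEdgeless : ∀ {m} → Graph m → Set
IsEdgeless {m} Δ = ∀ (i j : Fin m) → adj Δ i j ≡ false

private
  eqb : ∀ {k} → Fin k → Fin k → Bool
  eqb a b = does (a ≟ b)

  eqb-sym : ∀ {k} (a b : Fin k) → eqb a b ≡ eqb b a
  eqb-sym a b with a ≟ b | b ≟ a
  ... | yes _ | yes _ = refl
  ... | no _  | no _  = refl
  ... | yes e | no ne = ⊥-elim (ne (sym e))
  ... | no ne | yes e = ⊥-elim (ne (sym e))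

  eqb-refl : ∀ {k} (a : Fin k) → eqb a a ≡ true
  eqb-refl a with a ≟ a
  ... | yes _ = refl
  ... | no ne = ⊥-elim (ne refl)

  lexAdj : ∀ {k m} → Graph k → Graph m → Fin k × Fin m → Fin k × Fin m → Bool
  lexAdj Θ Δ (θ₁ , δ₁) (θ₂ , δ₂) = (eqb θ₁ θ₂ ∧ adj Δ δ₁ δ₂) ∨ adj Θ θ₁ θ₂

  lexAdj-sym : ∀ {k m} (Θ : Graph k) (Δ : Graph m) u v → lexAdj Θ Δ u v ≡ lexAdj Θ Δ v u
  lexAdj-sym Θ Δ (θ₁ , δ₁) (θ₂ , δ₂)
    rewrite eqb-sym θ₁ θ₂ | symm Δ δ₁ δ₂ | symm Θ θ₁ θ₂ = refl

  lexAdj-irr : ∀ {k m} (Θ : Graph k) (Δ : Graph m) u → lexAdj Θ Δ u u ≡ false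
  lexAdj-irr Θ Δ (θ , δ) rewrite eqb-refl θ | irrefl Δ δ | irrefl Θ θ = refl

-- Lexicographic product Θ[Δ]: vertex set VΔ × VΘ (encoded as Fin (k * m) via remQuot);
-- (δ₁,θ₁) ~ (δ₂,θ₂) iff (θ₁ = θ₂ and δ₁ ~ δ₂) or θ₁ ~ θ₂.
lex : ∀ {k m} → Graph k → Graph m → Graph (k * m)
lex {k} {m} Θ Δ = record
  { adj    = λ u v → lexAdj Θ Δ (remQuot m u) (remQuot m v)
  ; symm   = λ u v → lexAdj-sym Θ Δ (remQuot m u) (remQuot m v)
  ; irrefl = λ u → lexAdj-irr Θ Δ (remQuot m u)
  }

{-# OPTIONS --safe #-}
module Submission where

-- A non-identity automorphism σ of minimal support, the support having prime size p, is a
-- single p-cycle: every non-trivial power of σ has the same support as σ, so ⟨σ⟩ moves the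
-- points of that support in orbits of one common length ℓ, and ℓ ∣ p. Vertices off a p-cycle
-- C = (c₀ … c_{p-1}) of σ are fixed by σ, hence adjacent to all or none of C, and adjacency
-- on C is invariant under i ↦ i + 1. So c_i ↦ c_{-i} is an automorphism, and for odd p it
-- moves only p - 1 vertices: no graph has motion p.
--
-- In a vertex-transitive Γ, an Aut(Γ)-invariant partition into modules presents Γ as Θ[Δ],
-- with Θ the quotient and Δ one part. If C is a clique or a coclique, its vertices are
-- closed or open twins, and the twin classes form such a partition. Otherwise C is a block:
-- were h(C) to meet C without lying inside it, the adjacency of h(c_a) and h(c_b) would take
-- a constant value β for a in the periodic set M = {a | h(c_a) ∈ C} and b in its nonempty
-- complement. If adj(c₀, c_s) ≠ β, M would be closed under a ↦ a + s, hence (p being prime)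
-- all of ℤ_p; so C would be a clique or a coclique after all. The translates of C then form
-- the partition, with Δ = Γ[C] circulant.

open import Defs
open import Data.Bool using (Bool; true; false; T; not; _∧_; _∨_; if_then_else_)
import Data.Bool.Properties as Bool
open import Data.Bool.Properties using (T-∧; T-≡; T-not-≡; ∧-zeroʳ; ∧-identityʳ; ∨-identityʳ)
open import Data.Empty using (⊥; ⊥-elim)
open import Data.Fin using (Fin; zero; suc; toℕ; _≟_; fromℕ<; combine; remQuot)
import Data.Fin as Fin
import Data.Fin.Properties as Finₚ
open import Data.Fin.Properties
  using (any?; all?; ¬∀⟶∃¬; ¬∀⟶∃¬-smallest; pigeonhole; cantor-schröder-bernstein; suc-injective;
         toℕ-injective; toℕ-inject; toℕ-fromℕ<; toℕ<n; remQuot-combine; combine-remQuot)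
open import Data.List using (length; filter; tabulate)
open import Data.Nat
  using (ℕ; zero; suc; _+_; _*_; _∸_; _<_; _≤_; z≤n; s≤s; s≤s⁻¹; NonZero; pred; >-nonZero; >-nonZero⁻¹)
open import Data.Nat.Coprimality using (prime⇒coprime; coprime-Bézout) renaming (sym to coprime-sym)
open import Data.Nat.DivMod
  using (_%_; _/_; _mod_; m≡m%n+[m/n]*n; m%n<n; m%n%n≡m%n; %-distribˡ-+; [m+n]%n≡m%n; m<n⇒m%n≡m; n%n≡0)
open import Data.Nat.Divisibility using (_∣_; divides; _∣0; ∣m∣n⇒∣m+n; ∣-refl)
open import Data.Nat.GCD using (module Bézout)
open import Data.Nat.Induction using (<-rec)
open import Data.Nat.Primality using (Prime; prime⇒irreducible; prime⇒nonZero)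
open import Data.Nat.Properties
  using (+-assoc; +-comm; +-suc; +-identityʳ; *-comm; *-identityʳ; +-cancelʳ-≡; suc-pred; <-cmp; <-trans;
         ≤-<-trans; <-≤-trans; ≤-trans; ≤-reflexive; <⇒≤; <⇒≢; n≤1+n; 1+n≰n; m<m+n; m∸n≤m; m<n⇒0<n∸m;
         m∸n+n≡m; m∸[m∸n]≡n; m+[n∸m]≡n; n<1+n; module ≤-Reasoning)
open import Data.Product using (Σ; ∃; _×_; _,_; proj₁; proj₂; uncurry)
open import Data.Sum using (_⊎_; inj₁; inj₂)
open import Function using (_∘_; id; _⇔_; mk⇔; Equivalence; case_of_)
open import Function.Bundles using (Inverse; mk↔ₛ′)
open import Function.Definitions using (Injective)
open import Level using (0ℓ)
open import Relation.Binary using (Rel; IsDecEquivalence; tri<; tri≈; tri>)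
open import Relation.Binary.PropositionalEquality
  using (_≡_; _≢_; refl; sym; trans; cong; cong-app; cong₂; subst; subst₂; module ≡-Reasoning)
open import Relation.Nullary using (¬_; Dec; yes; no; does; ¬?; contradiction)
open import Relation.Nullary.Decidable
  using (⌊_⌋; toWitness; fromWitness; decidable-stable; does-⇔; isYes≗does; T?; _→-dec_)
open import Relation.Unary using (Pred; Decidable)

-- Counting and searching in Fin n

count : ∀ {n} → (Fin n → Bool) → ℕ
count {zero}  P = 0
count {suc n} P = if P zero then suc (count (P ∘ suc)) else count (P ∘ suc)

_⊆ᵇ_ : ∀ {n} → (Fin n → Bool) → (Fin n → Bool) → Set
P ⊆ᵇ Q = ∀ v → T (P v) → T (Q v)

count-cong : ∀ {n} {P Q : Fin n → Bool} → (∀ v → P v ≡ Q v) → count P ≡ count Q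
count-cong {zero}  P≡Q = refl
count-cong {suc n} {P} {Q} P≡Q
  rewrite P≡Q zero | count-cong {P = P ∘ suc} {Q ∘ suc} (P≡Q ∘ suc) = refl

count-mono : ∀ {n} {P Q : Fin n → Bool} → P ⊆ᵇ Q → count P ≤ count Q
count-mono {zero} P⊆Q = z≤n
count-mono {suc n} {P} {Q} P⊆Q with P zero in P₀ | Q zero in Q₀
... | true  | true  = s≤s (count-mono (P⊆Q ∘ suc))
... | false | true  = ≤-trans (count-mono (P⊆Q ∘ suc)) (n≤1+n _)
... | false | false = count-mono (P⊆Q ∘ suc)
... | true  | false = ⊥-elim (subst T Q₀ (P⊆Q zero (subst T (sym P₀) _)))

count-≤⇒⊇ : ∀ {n} {P Q : Fin n → Bool} → P ⊆ᵇ Q → count Q ≤ count P → Q ⊆ᵇ P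
count-≤⇒⊇ {suc n} {P} {Q} P⊆Q Q≤P v Qv with P zero in P₀ | Q zero in Q₀ | v
... | true  | true  | zero  = subst T (sym P₀) _
... | true  | true  | suc v = count-≤⇒⊇ (P⊆Q ∘ suc) (s≤s⁻¹ Q≤P) v Qv
... | false | false | zero  = ⊥-elim (subst T Q₀ Qv)
... | false | false | suc v = count-≤⇒⊇ (P⊆Q ∘ suc) Q≤P v Qv
... | false | true  | _     = ⊥-elim (1+n≰n (≤-trans Q≤P (count-mono (P⊆Q ∘ suc))))
... | true  | false | _     = ⊥-elim (subst T Q₀ (P⊆Q zero (subst T (sym P₀) _)))

count-split : ∀ {n} (P Q : Fin n → Bool) →
  count P ≡ count (λ v → P v ∧ not (Q v)) + count (λ v → P v ∧ Q v)
count-split {zero}  P Q = refl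
count-split {suc n} P Q with P zero | Q zero
... | true  | true  = trans (cong suc (count-split (P ∘ suc) (Q ∘ suc))) (sym (+-suc _ _))
... | true  | false = cong suc (count-split (P ∘ suc) (Q ∘ suc))
... | false | _     = count-split (P ∘ suc) (Q ∘ suc)

count-none : ∀ {n} {P : Fin n → Bool} → (∀ v → ¬ T (P v)) → count P ≡ 0
count-none {zero}  ∉P = refl
count-none {suc n} {P} ∉P with P zero in P₀
... | true  = ⊥-elim (∉P zero (subst T (sym P₀) _))
... | false = count-none (∉P ∘ suc)

count≡0⇒∉ : ∀ {n} {P : Fin n → Bool} → count P ≡ 0 → ∀ v → ¬ T (P v)
count≡0⇒∉ {suc n} {P} #P≡0 v Pv with P zero in P₀ | #P≡0 | v
... | true  | ()    | _
... | false | _     | zero  = subst T P₀ Pv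
... | false | #P′≡0 | suc v = count≡0⇒∉ {P = P ∘ suc} #P′≡0 v Pv

enumerate : ∀ {n} (P : Fin n → Bool) → Fin (count P) → Fin n
enumerate {suc n} P = extend (P zero) (enumerate (P ∘ suc))
  where
  extend : ∀ {k} (b : Bool) → (Fin k → Fin n) → Fin (if b then suc k else k) → Fin (suc n)
  extend true  e zero    = zero
  extend true  e (suc i) = suc (e i)
  extend false e i       = suc (e i)

enumerate-injective : ∀ {n} (P : Fin n → Bool) → Injective _≡_ _≡_ (enumerate P)
enumerate-injective {suc n} P {i} {j} with P zero | i | j
... | true  | zero  | zero  = λ _ → refl
... | true  | zero  | suc _ = λ ()
... | true  | suc _ | zero  = λ ()
... | true  | suc i | suc j = cong suc ∘ enumerate-injective (P ∘ suc) ∘ suc-injective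
... | false | i     | j     = enumerate-injective (P ∘ suc) ∘ suc-injective

enumerate-sound : ∀ {n} (P : Fin n → Bool) i → T (P (enumerate P i))
enumerate-sound {suc n} P i with P zero in P₀ | i
... | true  | zero  = subst T (sym P₀) _
... | true  | suc i = enumerate-sound (P ∘ suc) i
... | false | i     = enumerate-sound (P ∘ suc) i

enumerate-complete : ∀ {n} (P : Fin n → Bool) v → T (P v) → ∃ λ i → enumerate P i ≡ v
enumerate-complete {suc n} P v Pv with P zero in P₀ | v
... | true  | zero  = zero , refl
... | true  | suc v = let i , eq = enumerate-complete (P ∘ suc) v Pv in suc i , cong suc eq
... | false | zero  = ⊥-elim (subst T P₀ Pv)
... | false | suc v = let i , eq = enumerate-complete (P ∘ suc) v Pv in i , cong suc eq

count-image : ∀ {n m} {P : Fin n → Bool} (f : Fin m → Fin n) → Injective _≡_ _≡_ f →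
  (∀ i → T (P (f i))) → (∀ v → T (P v) → ∃ λ i → f i ≡ v) → count P ≡ m
count-image {m = m} {P} f f-injective f-sound f-complete =
  cantor-schröder-bernstein {f = to} {g = from}
    (λ eq → enumerate-injective P (trans (sym (f-to _)) (trans (cong f eq) (f-to _))))
    (λ eq → f-injective (trans (sym (enumerate-from _)) (trans (cong (enumerate P) eq) (enumerate-from _))))
  where
  to : Fin (count P) → Fin m
  to i = proj₁ (f-complete (enumerate P i) (enumerate-sound P i))
  f-to : ∀ i → f (to i) ≡ enumerate P i
  f-to i = proj₂ (f-complete (enumerate P i) (enumerate-sound P i))
  from : Fin m → Fin (count P)
  from j = proj₁ (enumerate-complete P (f j) (f-sound j))
  enumerate-from : ∀ j → enumerate P (from j) ≡ f j
  enumerate-from j = proj₂ (enumerate-complete P (f j) (f-sound j))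

length-filter-tabulate : ∀ {a q} {A : Set a} {n} {Q : Pred A q} (Q? : Decidable Q) (g : Fin n → A) →
  length (filter Q? (tabulate g)) ≡ count (λ i → ⌊ Q? (g i) ⌋)
length-filter-tabulate {n = zero}  Q? g = refl
length-filter-tabulate {n = suc n} Q? g with Q? (g zero)
... | yes _ = cong suc (length-filter-tabulate Q? (g ∘ suc))
... | no _  = length-filter-tabulate Q? (g ∘ suc)


IsLeast : ∀ {n p} → Pred (Fin n) p → Fin n → Set p
IsLeast P i = P i × (∀ {j} → j Fin.< i → ¬ P j)

least : ∀ {n p} {P : Pred (Fin n) p} → Decidable P → ∃ P → ∃ (IsLeast P)
least {n} {P = P} P? (i , Pi) with ¬∀⟶∃¬-smallest n (¬_ ∘ P) (¬? ∘ P?) (λ ∀¬P → ∀¬P i Pi)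
... | k , ¬¬Pk , ¬P<k = k , decidable-stable (P? k) ¬¬Pk , λ {j} j<k →
  subst (¬_ ∘ P) (toℕ-injective (trans (toℕ-inject (fromℕ< j<k)) (toℕ-fromℕ< j<k))) (¬P<k (fromℕ< j<k))

least-unique : ∀ {n p} {P : Pred (Fin n) p} {i j} → IsLeast P i → IsLeast P j → i ≡ j
least-unique {i = i} {j} (Pi , ¬P<i) (Pj , ¬P<j) with Finₚ.<-cmp i j
... | tri< i<j _ _ = contradiction Pi (¬P<j i<j)
... | tri≈ _ i≡j _ = i≡j
... | tri> _ _ j<i = contradiction Pj (¬P<i j<i)

injective⇒surjective : ∀ {m} (f : Fin m → Fin m) → Injective _≡_ _≡_ f → ∀ y → ∃ λ x → f x ≡ y
injective⇒surjective {m} f f-injective y =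
  toWitness (count-≤⇒⊇ {P = image} {Q = λ _ → true} (λ _ _ → _)
    (≤-reflexive (trans count-all (sym count-image-f))) y _)
  where
  image : Fin m → Bool
  image y = ⌊ any? (λ x → f x ≟ y) ⌋
  count-image-f : count image ≡ m
  count-image-f = count-image f f-injective (λ x → fromWitness (x , refl)) (λ y → toWitness)
  count-all : count {m} (λ _ → true) ≡ m
  count-all = count-image {P = λ _ → true} id id (λ _ → _) (λ y _ → y , refl)

distinct⇒2≤ : ∀ {m} {i j : Fin m} → i ≢ j → 2 ≤ m
distinct⇒2≤ {suc zero}    {zero} {zero} i≢j = contradiction refl i≢j
distinct⇒2≤ {suc (suc m)}               _   = s≤s (s≤s z≤n)

-- Automorphisms

module _ {n} {Γ : Graph n} where
  open import Function.Endo.Propositional (Fin n) using (_^_)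

  app⁻¹ : Aut Γ → Fin n → Fin n
  app⁻¹ σ = Inverse.from (Aut.perm σ)

  app-app⁻¹ : ∀ (σ : Aut Γ) y → app σ (app⁻¹ σ y) ≡ y
  app-app⁻¹ σ = Inverse.strictlyInverseˡ (Aut.perm σ)

  app⁻¹-app : ∀ (σ : Aut Γ) x → app⁻¹ σ (app σ x) ≡ x
  app⁻¹-app σ = Inverse.strictlyInverseʳ (Aut.perm σ)

  app-injective : ∀ (σ : Aut Γ) → Injective _≡_ _≡_ (app σ)
  app-injective σ {x} {y} eq = trans (sym (app⁻¹-app σ x)) (trans (cong (app⁻¹ σ) eq) (app⁻¹-app σ y))

  adj-app : ∀ (σ : Aut Γ) x y → adj Γ (app σ x) (app σ y) ≡ adj Γ x y
  adj-app = Aut.preserve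

  adj-appˡ : ∀ (σ : Aut Γ) x y → adj Γ (app σ x) y ≡ adj Γ x (app⁻¹ σ y)
  adj-appˡ σ x y = trans (cong (adj Γ (app σ x)) (sym (app-app⁻¹ σ y))) (adj-app σ x (app⁻¹ σ y))

  adj-app⁻¹ˡ : ∀ (σ : Aut Γ) x y → adj Γ (app⁻¹ σ x) y ≡ adj Γ x (app σ y)
  adj-app⁻¹ˡ σ x y =
    trans (sym (adj-app σ (app⁻¹ σ x) y)) (cong (λ z → adj Γ z (app σ y)) (app-app⁻¹ σ x))

  automorphism : (f g : Fin n → Fin n) → (∀ y → f (g y) ≡ y) → (∀ x → g (f x) ≡ x) →
                 (∀ x y → adj Γ (f x) (f y) ≡ adj Γ x y) → Aut Γ
  automorphism f g f∘g g∘f f-adj = record { perm = mk↔ₛ′ f g f∘g g∘f ; preserve = f-adj }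

  infix  10 _⁻¹ᴬ
  infixr 9  _∘ᴬ_

  _⁻¹ᴬ : Aut Γ → Aut Γ
  σ ⁻¹ᴬ = automorphism (app⁻¹ σ) (app σ) (app⁻¹-app σ) (app-app⁻¹ σ)
    (λ x y → trans (adj-app⁻¹ˡ σ x (app⁻¹ σ y)) (cong (adj Γ x) (app-app⁻¹ σ y)))

  _∘ᴬ_ : Aut Γ → Aut Γ → Aut Γ
  σ ∘ᴬ τ = automorphism (app σ ∘ app τ) (app⁻¹ τ ∘ app⁻¹ σ)
    (λ y → trans (cong (app σ) (app-app⁻¹ τ _)) (app-app⁻¹ σ y))
    (λ x → trans (cong (app⁻¹ τ) (app⁻¹-app σ _)) (app⁻¹-app τ x))
    (λ x y → trans (adj-app σ _ _) (adj-app τ x y))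

  _^ᴬ_ : Aut Γ → ℕ → Aut Γ
  σ ^ᴬ zero  = automorphism id id (λ _ → refl) (λ _ → refl) (λ _ _ → refl)
  σ ^ᴬ suc a = σ ∘ᴬ (σ ^ᴬ a)

  app-^ᴬ : ∀ (σ : Aut Γ) a v → app (σ ^ᴬ a) v ≡ (app σ ^ a) v
  app-^ᴬ σ zero    v = refl
  app-^ᴬ σ (suc a) v = cong (app σ) (app-^ᴬ σ a v)

support : ∀ {n} → (Fin n → Fin n) → Fin n → Bool
support f v = ⌊ ¬? (f v ≟ v) ⌋

moved≡count-support : ∀ {n} {Γ : Graph n} (σ : Aut Γ) → moved σ ≡ count (support (app σ))
moved≡count-support σ = length-filter-tabulate (λ v → ¬? (app σ v ≟ v)) id

-- Orbits of an injective map

module Iteration {n} {f : Fin n → Fin n} (f-injective : Injective _≡_ _≡_ f) where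
  open import Function.Endo.Propositional (Fin n) using (_^_; ^-homo)

  ^-+ : ∀ a b x → (f ^ (a + b)) x ≡ (f ^ a) ((f ^ b) x)
  ^-+ a b = cong-app (^-homo f a b)

  ^-injective : ∀ a → Injective _≡_ _≡_ (f ^ a)
  ^-injective zero    eq = eq
  ^-injective (suc a) eq = ^-injective a (f-injective eq)

  ^-return : ∀ {a b} x → a < b → (f ^ a) x ≡ (f ^ b) x → (f ^ (b ∸ a)) x ≡ x
  ^-return {a} {b} x a<b eq = ^-injective a (begin
    (f ^ a) ((f ^ (b ∸ a)) x)  ≡⟨ ^-+ a (b ∸ a) x ⟨
    (f ^ (a + (b ∸ a))) x      ≡⟨ cong (λ k → (f ^ k) x) (m+[n∸m]≡n (<⇒≤ a<b)) ⟩
    (f ^ b) x                  ≡⟨ eq ⟨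
    (f ^ a) x                  ∎)
    where open ≡-Reasoning

  ^-returns : ∀ x → ∃ λ (k : Fin n) → (f ^ suc (toℕ k)) x ≡ x
  ^-returns x with pigeonhole (n<1+n n) (λ i → (f ^ toℕ i) x)
  ... | i , j , i<j , fⁱx≡fʲx
    with toℕ j ∸ toℕ i | m<n⇒0<n∸m i<j | m∸n≤m (toℕ j) (toℕ i) | ^-return {toℕ i} {toℕ j} x i<j fⁱx≡fʲx
  ... | suc d | _ | d<j | fᵈx≡x = fromℕ< d<n , subst (λ e → (f ^ suc e) x ≡ x) (sym (toℕ-fromℕ< d<n)) fᵈx≡x
    where
    d<n : d < n
    d<n = <-≤-trans d<j (s≤s⁻¹ (toℕ<n j))

  module Orbits (ℓ : ℕ) .{{_ : NonZero ℓ}} (S : Fin n → Bool)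
    (period : ∀ {y} → T (S y) → (f ^ ℓ) y ≡ y)
    (aperiodic : ∀ {y} → T (S y) → ∀ {b} → 0 < b → b < ℓ → (f ^ b) y ≢ y) where

    ^-*ℓ : ∀ {y} → T (S y) → ∀ k → (f ^ (k * ℓ)) y ≡ y
    ^-*ℓ Sy zero    = refl
    ^-*ℓ Sy (suc k) = trans (^-+ ℓ (k * ℓ) _) (trans (cong (f ^ ℓ) (^-*ℓ Sy k)) (period Sy))

    ^-%ℓ : ∀ {y} → T (S y) → ∀ a → (f ^ a) y ≡ (f ^ (a % ℓ)) y
    ^-%ℓ {y} Sy a = begin
      (f ^ a) y                            ≡⟨ cong (λ k → (f ^ k) y) (m≡m%n+[m/n]*n a ℓ) ⟩
      (f ^ (a % ℓ + (a / ℓ) * ℓ)) y         ≡⟨ ^-+ (a % ℓ) _ y ⟩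
      (f ^ (a % ℓ)) ((f ^ ((a / ℓ) * ℓ)) y) ≡⟨ cong (f ^ (a % ℓ)) (^-*ℓ Sy (a / ℓ)) ⟩
      (f ^ (a % ℓ)) y                      ∎
      where open ≡-Reasoning

    InOrbit : Fin n → Fin n → Set
    InOrbit y v = ∃ λ (b : Fin ℓ) → (f ^ toℕ b) y ≡ v

    inOrbit? : ∀ y v → Dec (InOrbit y v)
    inOrbit? y v = any? λ b → (f ^ toℕ b) y ≟ v

    orbit : Fin n → Fin n → Bool
    orbit y v = ⌊ inOrbit? y v ⌋

    inOrbit-^ : ∀ {y} → T (S y) → ∀ a → InOrbit y ((f ^ a) y)
    inOrbit-^ Sy a = a mod ℓ , trans (cong (λ k → (f ^ k) _) (toℕ-fromℕ< (m%n<n a ℓ))) (sym (^-%ℓ Sy a))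

    inOrbit-f : ∀ {y} → T (S y) → ∀ v → InOrbit y (f v) ⇔ InOrbit y v
    inOrbit-f {y} Sy v = mk⇔ backward forward
      where
      forward : InOrbit y v → InOrbit y (f v)
      forward (b , fᵇy≡v) = subst (InOrbit y ∘ f) fᵇy≡v (inOrbit-^ Sy (suc (toℕ b)))
      backward : InOrbit y (f v) → InOrbit y v
      backward (b , fᵇy≡fv) = subst (InOrbit y) (f-injective (begin
        f ((f ^ (toℕ b + pred ℓ)) y)   ≡⟨ cong (λ k → (f ^ k) y) (+-suc (toℕ b) (pred ℓ)) ⟨
        (f ^ (toℕ b + suc (pred ℓ))) y ≡⟨ cong (λ k → (f ^ (toℕ b + k)) y) (suc-pred ℓ) ⟩
        (f ^ (toℕ b + ℓ)) y            ≡⟨ ^-+ (toℕ b) ℓ y ⟩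
        (f ^ toℕ b) ((f ^ ℓ) y)        ≡⟨ cong (f ^ toℕ b) (period Sy) ⟩
        (f ^ toℕ b) y                  ≡⟨ fᵇy≡fv ⟩
        f v                            ∎)) (inOrbit-^ Sy (toℕ b + pred ℓ))
        where open ≡-Reasoning

    orbit-f : ∀ {y} → T (S y) → ∀ v → orbit y (f v) ≡ orbit y v
    orbit-f {y} Sy v = trans (isYes≗does (inOrbit? y (f v)))
      (trans (does-⇔ (inOrbit-f Sy v) (inOrbit? y (f v)) (inOrbit? y v)) (sym (isYes≗does (inOrbit? y v))))

    difference<ℓ : ∀ (b b′ : Fin ℓ) → toℕ b ∸ toℕ b′ < ℓ
    difference<ℓ b b′ = ≤-<-trans (m∸n≤m (toℕ b) (toℕ b′)) (toℕ<n b)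

    exponent-injective : ∀ {y} → T (S y) → Injective _≡_ _≡_ (λ (b : Fin ℓ) → (f ^ toℕ b) y)
    exponent-injective {y} Sy {b} {b′} eq with <-cmp (toℕ b) (toℕ b′)
    ... | tri≈ _ b≡b′ _ = toℕ-injective b≡b′
    ... | tri< b<b′ _ _ = contradiction (^-return y b<b′ eq) (aperiodic Sy (m<n⇒0<n∸m b<b′) (difference<ℓ b′ b))
    ... | tri> _ _ b′<b = contradiction (^-return y b′<b (sym eq)) (aperiodic Sy (m<n⇒0<n∸m b′<b) (difference<ℓ b b′))


    count-orbit : ∀ {y} → T (S y) → count (orbit y) ≡ ℓ
    count-orbit {y} Sy = count-image _ (exponent-injective Sy)
      (λ b → fromWitness {a? = inOrbit? y _} (b , refl)) (λ v → toWitness {a? = inOrbit? y v})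

    Invariant : (Fin n → Bool) → Set
    Invariant U = ∀ v → U (f v) ≡ U v

    Invariant-^ : ∀ {U} → Invariant U → ∀ a v → U ((f ^ a) v) ≡ U v
    Invariant-^ U-f zero    v = refl
    Invariant-^ U-f (suc a) v = trans (U-f _) (Invariant-^ U-f a v)

    count-remove-orbit : ∀ {U} → Invariant U → U ⊆ᵇ S → ∀ {y} → T (U y) →
      count U ≡ count (λ v → U v ∧ not (orbit y v)) + ℓ
    count-remove-orbit {U} U-f U⊆S {y} Uy = trans (count-split U (orbit y))
      (cong (count (λ v → U v ∧ not (orbit y v)) +_) (trans (count-cong U∧orbit≡orbit) (count-orbit (U⊆S y Uy))))
      where
      U∧orbit≡orbit : ∀ v → U v ∧ orbit y v ≡ orbit y v
      U∧orbit≡orbit v with orbit y v in y~v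
      ... | false = ∧-zeroʳ (U v)
      ... | true  with toWitness {a? = inOrbit? y v} (subst T (sym y~v) _)
      ... | b , refl = trans (∧-identityʳ _) (trans (Invariant-^ U-f (toℕ b) y) (Equivalence.to T-≡ Uy))

    ℓ∣count : ∀ {U} → Invariant U → U ⊆ᵇ S → ℓ ∣ count U
    ℓ∣count {U} U-f U⊆S = <-rec Claim step (count U) U-f U⊆S refl
      where
      Claim : ℕ → Set
      Claim k = ∀ {U} → Invariant U → U ⊆ᵇ S → count U ≡ k → ℓ ∣ k
      step : ∀ k → (∀ {j} → j < k → Claim j) → Claim k
      step _ rec {U} U-f U⊆S refl with any? (λ v → T? (U v))
      ... | no ∄U = subst (ℓ ∣_) (sym (count-none (λ v Uv → ∄U (v , Uv)))) (ℓ ∣0)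
      ... | yes (y , Uy) = subst (ℓ ∣_) (sym #U≡#U′+ℓ) (∣m∣n⇒∣m+n (rec #U′<#U U′-f U′⊆S refl) ∣-refl)
        where
        U′ : Fin n → Bool
        U′ v = U v ∧ not (orbit y v)
        U′-f : Invariant U′
        U′-f v = cong₂ _∧_ (U-f v) (cong not (orbit-f (U⊆S y Uy) v))
        U′⊆S : U′ ⊆ᵇ S
        U′⊆S v U′v = U⊆S v (proj₁ (Equivalence.to T-∧ U′v))
        #U≡#U′+ℓ : count U ≡ count U′ + ℓ
        #U≡#U′+ℓ = count-remove-orbit U-f U⊆S Uy
        #U′<#U : count U′ < count U
        #U′<#U = subst (count U′ <_) (sym #U≡#U′+ℓ) (m<m+n (count U′) (>-nonZero⁻¹ ℓ))

-- Cycles of an automorphism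

module Cycle {n} {Γ : Graph n} {q} (σ : Aut Γ) (cycle : IsCycle {Γ = Γ} (suc q) σ) where

  p : ℕ
  p = suc q

  c : Fin p → Fin n
  c = proj₁ cycle

  c-injective : ∀ i j → c i ≡ c j → i ≡ j
  c-injective = proj₁ (proj₂ cycle)

  σ-c : ∀ i → app σ (c i) ≡ c (nextMod i)
  σ-c = proj₁ (proj₂ (proj₂ cycle))

  σ-fixes : ∀ y → (∀ i → c i ≢ y) → app σ y ≡ y
  σ-fixes = proj₂ (proj₂ (proj₂ cycle))

  OnCycle : Fin n → Set
  OnCycle z = ∃ λ i → c i ≡ z

  onCycle? : Decidable OnCycle
  onCycle? z = any? λ i → c i ≟ z

  c̃ : ℕ → Fin n
  c̃ a = c (a mod p)

  c̃-cong : ∀ a b → a % p ≡ b % p → c̃ a ≡ c̃ b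
  c̃-cong a b a≡b = cong c (toℕ-injective (trans (toℕ-fromℕ< _) (trans a≡b (sym (toℕ-fromℕ< _)))))

  c̃-toℕ : ∀ i → c̃ (toℕ i) ≡ c i
  c̃-toℕ i = cong c (toℕ-injective (trans (toℕ-fromℕ< _) (m<n⇒m%n≡m (toℕ<n i))))

  c̃-periodic : ∀ a → c̃ (a + p) ≡ c̃ a
  c̃-periodic a = c̃-cong (a + p) a ([m+n]%n≡m%n a p)

  σ-c̃ : ∀ a → app σ (c̃ a) ≡ c̃ (suc a)
  σ-c̃ a = trans (σ-c (a mod p)) (c̃-cong (suc (toℕ (a mod p))) (suc a) (begin
    suc (toℕ (a mod p)) % p  ≡⟨ cong (λ r → suc r % p) (toℕ-fromℕ< (m%n<n a p)) ⟩
    (1 + a % p) % p          ≡⟨ %-distribˡ-+ 1 (a % p) p ⟩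
    (1 % p + a % p % p) % p  ≡⟨ cong (λ r → (1 % p + r) % p) (m%n%n≡m%n a p) ⟩
    (1 % p + a % p) % p      ≡⟨ %-distribˡ-+ 1 a p ⟨
    suc a % p                ∎))
    where open ≡-Reasoning

  adj-c̃-+ : ∀ a b t → adj Γ (c̃ (a + t)) (c̃ (b + t)) ≡ adj Γ (c̃ a) (c̃ b)
  adj-c̃-+ a b zero    = cong₂ (λ a b → adj Γ (c̃ a) (c̃ b)) (+-identityʳ a) (+-identityʳ b)
  adj-c̃-+ a b (suc t) = begin
    adj Γ (c̃ (a + suc t)) (c̃ (b + suc t))
      ≡⟨ cong₂ (λ a b → adj Γ (c̃ a) (c̃ b)) (+-suc a t) (+-suc b t) ⟩
    adj Γ (c̃ (suc (a + t))) (c̃ (suc (b + t)))          ≡⟨ cong₂ (adj Γ) (σ-c̃ (a + t)) (σ-c̃ (b + t)) ⟨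
    adj Γ (app σ (c̃ (a + t))) (app σ (c̃ (b + t)))      ≡⟨ adj-app σ _ _ ⟩
    adj Γ (c̃ (a + t)) (c̃ (b + t))                      ≡⟨ adj-c̃-+ a b t ⟩
    adj Γ (c̃ a) (c̃ b)                                  ∎
    where open ≡-Reasoning

  off-cycle-uniform : ∀ {z} → ¬ OnCycle z → ∀ i j → adj Γ z (c i) ≡ adj Γ z (c j)
  off-cycle-uniform {z} z∉C i j = begin
    adj Γ z (c i)          ≡⟨ cong (adj Γ z) (c̃-toℕ i) ⟨
    adj Γ z (c̃ (toℕ i))    ≡⟨ from-zero (toℕ i) ⟩
    adj Γ z (c̃ 0)          ≡⟨ from-zero (toℕ j) ⟨
    adj Γ z (c̃ (toℕ j))    ≡⟨ cong (adj Γ z) (c̃-toℕ j) ⟩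
    adj Γ z (c j)          ∎
    where
    open ≡-Reasoning
    σz≡z : app σ z ≡ z
    σz≡z = σ-fixes z (λ i cᵢ≡z → z∉C (i , cᵢ≡z))
    from-zero : ∀ a → adj Γ z (c̃ a) ≡ adj Γ z (c̃ 0)
    from-zero zero    = refl
    from-zero (suc a) =
      trans (cong₂ (adj Γ) (sym σz≡z) (sym (σ-c̃ a))) (trans (adj-app σ z (c̃ a)) (from-zero a))

  Uniform : Bool → Set
  Uniform β = ∀ s → s ≢ zero → adj Γ (c zero) (c s) ≡ β

  uniform-ordered : ∀ {β} → Uniform β → ∀ {i j} → toℕ i < toℕ j → adj Γ (c i) (c j) ≡ β
  uniform-ordered {β} uniform {i} {j} i<j = begin
    adj Γ (c i) (c j)
      ≡⟨ cong₂ (adj Γ) (c̃-toℕ i) (trans (cong c̃ (m∸n+n≡m (<⇒≤ i<j))) (c̃-toℕ j)) ⟨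
    adj Γ (c̃ (0 + toℕ i)) (c̃ (t + toℕ i))   ≡⟨ adj-c̃-+ 0 t (toℕ i) ⟩
    adj Γ (c zero) (c̃ t)                    ≡⟨ uniform (t mod p) t≢0 ⟩
    β                                       ∎
    where
    open ≡-Reasoning
    t : ℕ
    t = toℕ j ∸ toℕ i
    t≢0 : t mod p ≢ zero
    t≢0 eq = <⇒≢ (m<n⇒0<n∸m i<j) (sym (begin
      t                ≡⟨ m<n⇒m%n≡m (≤-<-trans (m∸n≤m (toℕ j) (toℕ i)) (toℕ<n j)) ⟨
      t % p            ≡⟨ toℕ-fromℕ< _ ⟨
      toℕ (t mod p)    ≡⟨ cong toℕ eq ⟩
      0                ∎))

  uniform-pairs : ∀ {β} → Uniform β → ∀ i j → i ≢ j → adj Γ (c i) (c j) ≡ β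
  uniform-pairs uniform i j i≢j with <-cmp (toℕ i) (toℕ j)
  ... | tri< i<j _ _ = uniform-ordered uniform i<j
  ... | tri≈ _ i≡j _ = contradiction (toℕ-injective i≡j) i≢j
  ... | tri> _ _ j<i = trans (symm Γ (c i) (c j)) (uniform-ordered uniform j<i)

-- Motion

module MinimalAutomorphism {n} {Γ : Graph n} {p} (p-prime : Prime p)
  (σ : Aut Γ) {x₀} (σx₀≢x₀ : app σ x₀ ≢ x₀) (moved-σ : moved σ ≡ p)
  (minimal : ∀ (τ : Aut Γ) → NonIdentity τ → p ≤ moved τ) where

  open Iteration (app-injective σ)
  open import Function.Endo.Propositional (Fin n) using (_^_)

  f : Fin n → Fin n
  f = app σ

  S : Fin n → Bool
  S = support f

  x₀∈S : T (S x₀)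
  x₀∈S = fromWitness σx₀≢x₀

  count-S : count S ≡ p
  count-S = trans (sym (moved≡count-support σ)) moved-σ

  S-f : ∀ v → S (f v) ≡ S v
  S-f v with f (f v) ≟ f v | f v ≟ v
  ... | yes _     | yes _     = refl
  ... | no  _     | no  _     = refl
  ... | yes ffv≡fv | no fv≢v  = contradiction (app-injective σ ffv≡fv) fv≢v
  ... | no ffv≢fv | yes fv≡v  = contradiction (cong f fv≡v) ffv≢fv

  support-^⊆S : ∀ a → support (f ^ a) ⊆ᵇ S
  support-^⊆S a v moves = fromWitness λ fv≡v → toWitness moves (fixed a fv≡v)
    where
    fixed : ∀ a → f v ≡ v → (f ^ a) v ≡ v
    fixed zero    _    = refl
    fixed (suc a) fv≡v = trans (cong f (fixed a fv≡v)) fv≡v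

  moved-power : ∀ a → moved (σ ^ᴬ a) ≡ count (support (f ^ a))
  moved-power a = trans (moved≡count-support (σ ^ᴬ a))
    (count-cong λ v → cong (λ w → ⌊ ¬? (w ≟ v) ⌋) (app-^ᴬ σ a v))

  power-dichotomy : ∀ a → (∀ v → (f ^ a) v ≡ v) ⊎ (S ⊆ᵇ support (f ^ a))
  power-dichotomy a with all? (λ v → (f ^ a) v ≟ v)
  ... | yes fixes-all = inj₁ fixes-all
  ... | no ¬fixes-all with ¬∀⟶∃¬ n _ (λ v → (f ^ a) v ≟ v) ¬fixes-all
  ... | v , fᵃv≢v = inj₂ (count-≤⇒⊇ (support-^⊆S a) (begin
    count S                   ≡⟨ count-S ⟩
    p                         ≤⟨ minimal (σ ^ᴬ a) (v , fᵃv≢v ∘ trans (sym (app-^ᴬ σ a v))) ⟩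
    moved (σ ^ᴬ a)            ≡⟨ moved-power a ⟩
    count (support (f ^ a))   ∎))
    where open ≤-Reasoning

  Returns : Fin n → Set
  Returns k = (f ^ suc (toℕ k)) x₀ ≡ x₀

  first-return : ∃ (IsLeast Returns)
  first-return = least (λ k → (f ^ suc (toℕ k)) x₀ ≟ x₀) (^-returns x₀)

  ℓ : ℕ
  ℓ = suc (toℕ (proj₁ first-return))

  period : ∀ v → (f ^ ℓ) v ≡ v
  period with power-dichotomy ℓ
  ... | inj₁ fixes-all = fixes-all
  ... | inj₂ S⊆moved   = contradiction (proj₁ (proj₂ first-return)) (toWitness (S⊆moved x₀ x₀∈S))

  aperiodic : ∀ {y} → T (S y) → ∀ {b} → 0 < b → b < ℓ → (f ^ b) y ≢ y
  aperiodic Sy {suc b} _ (s≤s b<k) with power-dichotomy (suc b)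
  ... | inj₁ fixes-all = λ _ → proj₂ (proj₂ first-return) b<k′
    (subst (λ e → (f ^ suc e) x₀ ≡ x₀) (sym (toℕ-fromℕ< b<n)) (fixes-all x₀))
    where
    b<n : b < n
    b<n = <-trans b<k (toℕ<n (proj₁ first-return))
    b<k′ : fromℕ< b<n Fin.< proj₁ first-return
    b<k′ = subst (_< _) (sym (toℕ-fromℕ< b<n)) b<k
  ... | inj₂ S⊆moved   = toWitness (S⊆moved _ Sy)

  open Orbits ℓ S (λ _ → period _) aperiodic

  ℓ≡p : ℓ ≡ p
  ℓ≡p with prime⇒irreducible p-prime (subst (ℓ ∣_) count-S (ℓ∣count S-f (λ _ → id)))
  ... | inj₁ ℓ≡1 = contradiction (subst (λ e → (f ^ e) x₀ ≡ x₀) ℓ≡1 (period x₀)) σx₀≢x₀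
  ... | inj₂ ℓ≡p = ℓ≡p

  S⊆orbit : S ⊆ᵇ orbit x₀
  S⊆orbit v Sv with orbit x₀ v in x₀~v
  ... | true  = _
  ... | false = count≡0⇒∉ #S∖orbit≡0 v (Equivalence.from T-∧ (Sv , Equivalence.from T-not-≡ x₀~v))
    where
    #S∖orbit≡0 : count (λ v → S v ∧ not (orbit x₀ v)) ≡ 0
    #S∖orbit≡0 = +-cancelʳ-≡ ℓ _ 0
      (trans (sym (count-remove-orbit S-f (λ _ → id) x₀∈S)) (trans count-S (sym ℓ≡p)))

  isCycle : IsCycle {Γ = Γ} p σ
  isCycle = subst (λ m → IsCycle {Γ = Γ} m σ) ℓ≡p (c , c-injective , f-c , f-fixes)
    where
    c : Fin ℓ → Fin n
    c i = (f ^ toℕ i) x₀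
    c-injective : ∀ i j → c i ≡ c j → i ≡ j
    c-injective i j = exponent-injective x₀∈S
    f-c : ∀ i → f (c i) ≡ c (nextMod i)
    f-c i = trans (^-%ℓ x₀∈S (suc (toℕ i)))
      (cong (λ e → (f ^ e) x₀) (sym (toℕ-fromℕ< (m%n<n (suc (toℕ i)) ℓ))))
    f-fixes : ∀ y → (∀ i → c i ≢ y) → f y ≡ y
    f-fixes y y∉c with f y ≟ y
    ... | yes fy≡y = fy≡y
    ... | no  fy≢y = let i , cᵢ≡y = toWitness (S⊆orbit y (fromWitness fy≢y)) in contradiction cᵢ≡y (y∉c i)

module Reflection {n} {Γ : Graph n} {r} (σ : Aut Γ) (cycle : IsCycle {Γ = Γ} (suc (suc r)) σ)
  (p-odd : ¬ 2 ∣ suc (suc r)) where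

  open Cycle σ cycle

  neg : Fin p → Fin p
  neg i = (p ∸ toℕ i) mod p

  neg-zero : neg zero ≡ zero
  neg-zero = toℕ-injective (trans (toℕ-fromℕ< _) (n%n≡0 p))

  toℕ-neg-suc : ∀ j → toℕ (neg (suc j)) ≡ p ∸ suc (toℕ j)
  toℕ-neg-suc j = trans (toℕ-fromℕ< _) (m<n⇒m%n≡m (s≤s (m∸n≤m (suc r) (toℕ j))))

  neg-involutive : ∀ i → neg (neg i) ≡ i
  neg-involutive zero    = trans (cong neg neg-zero) neg-zero
  neg-involutive (suc j) = toℕ-injective (begin
    toℕ (neg (neg (suc j)))         ≡⟨ toℕ-fromℕ< _ ⟩
    (p ∸ toℕ (neg (suc j))) % p     ≡⟨ cong (λ m → (p ∸ m) % p) (toℕ-neg-suc j) ⟩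
    (p ∸ (p ∸ suc (toℕ j))) % p     ≡⟨ cong (_% p) (m∸[m∸n]≡n (<⇒≤ (toℕ<n (suc j)))) ⟩
    suc (toℕ j) % p                 ≡⟨ m<n⇒m%n≡m (toℕ<n (suc j)) ⟩
    suc (toℕ j)                     ∎)
    where open ≡-Reasoning

  neg-suc≢suc : ∀ j → neg (suc j) ≢ suc j
  neg-suc≢suc j neg≡ = p-odd (divides (suc (toℕ j)) (begin
    p                                   ≡⟨ m∸n+n≡m (<⇒≤ (toℕ<n (suc j))) ⟨
    (p ∸ suc (toℕ j)) + suc (toℕ j)
      ≡⟨ cong (_+ suc (toℕ j)) (trans (sym (toℕ-neg-suc j)) (cong toℕ neg≡)) ⟩
    suc (toℕ j) + suc (toℕ j)           ≡⟨ cong (suc (toℕ j) +_) (+-identityʳ (suc (toℕ j))) ⟨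
    2 * suc (toℕ j)                     ≡⟨ *-comm 2 (suc (toℕ j)) ⟩
    suc (toℕ j) * 2                     ∎))
    where open ≡-Reasoning

  adj-neg : ∀ i j → adj Γ (c (neg i)) (c (neg j)) ≡ adj Γ (c i) (c j)
  adj-neg i j = begin
    adj Γ (c̃ (p ∸ toℕ i)) (c̃ (p ∸ toℕ j))
      ≡⟨ adj-c̃-+ (p ∸ toℕ i) (p ∸ toℕ j) (toℕ i + toℕ j) ⟨
    adj Γ (c̃ ((p ∸ toℕ i) + (toℕ i + toℕ j))) (c̃ ((p ∸ toℕ j) + (toℕ i + toℕ j)))
      ≡⟨ cong₂ (λ a b → adj Γ (c̃ a) (c̃ b)) (wrap i (toℕ j))
               (trans (cong (p ∸ toℕ j +_) (+-comm (toℕ i) (toℕ j))) (wrap j (toℕ i))) ⟩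
    adj Γ (c̃ (toℕ j + p)) (c̃ (toℕ i + p))
      ≡⟨ cong₂ (adj Γ) (trans (c̃-periodic (toℕ j)) (c̃-toℕ j)) (trans (c̃-periodic (toℕ i)) (c̃-toℕ i)) ⟩
    adj Γ (c j) (c i)
      ≡⟨ symm Γ (c j) (c i) ⟩
    adj Γ (c i) (c j) ∎
    where
    open ≡-Reasoning
    wrap : ∀ (i : Fin p) b → (p ∸ toℕ i) + (toℕ i + b) ≡ b + p
    wrap i b = begin
      (p ∸ toℕ i) + (toℕ i + b)   ≡⟨ +-assoc (p ∸ toℕ i) (toℕ i) b ⟨
      (p ∸ toℕ i) + toℕ i + b     ≡⟨ cong (_+ b) (m∸n+n≡m (<⇒≤ (toℕ<n i))) ⟩
      p + b                       ≡⟨ +-comm p b ⟩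
      b + p                       ∎

  ρ : Fin n → Fin n
  ρ v with onCycle? v
  ... | yes (i , _) = c (neg i)
  ... | no  _       = v

  ρ-c : ∀ i → ρ (c i) ≡ c (neg i)
  ρ-c i with onCycle? (c i)
  ... | yes (i′ , cᵢ′≡cᵢ) = cong (c ∘ neg) (c-injective i′ i cᵢ′≡cᵢ)
  ... | no  c∉C          = contradiction (i , refl) c∉C

  ρ-off : ∀ {v} → ¬ OnCycle v → ρ v ≡ v
  ρ-off {v} v∉C with onCycle? v
  ... | yes v∈C = contradiction v∈C v∉C
  ... | no  _   = refl

  ρ-involutive : ∀ v → ρ (ρ v) ≡ v
  ρ-involutive v with onCycle? v
  ... | yes (i , refl) = trans (ρ-c (neg i)) (cong c (neg-involutive i))
  ... | no  v∉C        = ρ-off v∉C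

  ρ-adj : ∀ x y → adj Γ (ρ x) (ρ y) ≡ adj Γ x y
  ρ-adj x y with onCycle? x | onCycle? y
  ... | yes (i , refl) | yes (j , refl) = adj-neg i j
  ... | yes (i , refl) | no  y∉C = begin
    adj Γ (c (neg i)) y      ≡⟨ symm Γ _ y ⟩
    adj Γ y (c (neg i))      ≡⟨ off-cycle-uniform y∉C (neg i) i ⟩
    adj Γ y (c i)            ≡⟨ symm Γ y _ ⟩
    adj Γ (c i) y            ∎
    where open ≡-Reasoning
  ... | no  x∉C | yes (j , refl) = off-cycle-uniform x∉C (neg j) j
  ... | no  _   | no  _          = refl

  reflection : Aut Γ
  reflection = automorphism ρ ρ ρ-involutive ρ-involutive ρ-adj

  ρ-moves : ∀ j → ρ (c (suc j)) ≢ c (suc j)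
  ρ-moves j ρc≡c = neg-suc≢suc j (c-injective _ _ (trans (sym (ρ-c (suc j))) ρc≡c))

  moved-reflection : moved reflection ≡ suc r
  moved-reflection = trans (moved≡count-support reflection)
    (count-image (c ∘ suc) (suc-injective ∘ c-injective _ _) (fromWitness ∘ ρ-moves) moved⇒c-suc)
    where
    moved⇒c-suc : ∀ v → T (support ρ v) → ∃ λ j → c (suc j) ≡ v
    moved⇒c-suc v ρv≢v = cases (onCycle? v) (toWitness ρv≢v)
      where
      cases : Dec (OnCycle v) → ρ v ≢ v → ∃ λ j → c (suc j) ≡ v
      cases (yes (suc j , cⱼ≡v)) _    = j , cⱼ≡v
      cases (yes (zero , c₀≡v))  ρv≢v =
        contradiction (subst (λ w → ρ w ≡ w) c₀≡v (trans (ρ-c zero) (cong c neg-zero))) ρv≢v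
      cases (no  v∉C)            ρv≢v = contradiction (ρ-off v∉C) ρv≢v

  reflection-nonIdentity : NonIdentity reflection
  reflection-nonIdentity = c (suc zero) , ρ-moves zero

¬HasMotion-oddPrime : ∀ {n} {Γ : Graph n} {p} → Prime p → ¬ 2 ∣ p → ¬ HasMotion Γ p
-- Prime 0 and Prime 1 are empty, so p = 2 + r is the only case.
¬HasMotion-oddPrime {p = suc (suc r)} p-prime p-odd ((σ , (_ , σx₀≢x₀) , moved-σ) , minimal) =
  1+n≰n (subst (suc (suc r) ≤_) moved-reflection (minimal reflection reflection-nonIdentity))
  where open Reflection σ (MinimalAutomorphism.isCycle p-prime σ σx₀≢x₀ moved-σ minimal) p-odd

-- Lexicographic decomposition

induced : ∀ {n m} → Graph n → (Fin m → Fin n) → Graph m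
induced Γ e = record
  { adj    = λ i j → adj Γ (e i) (e j)
  ; symm   = λ i j → symm Γ (e i) (e j)
  ; irrefl = irrefl Γ ∘ e
  }

adj-lex-combine : ∀ {k m} (Θ : Graph k) (Δ : Graph m) r i s j →
  adj (lex Θ Δ) (combine r i) (combine s j) ≡ (does (r ≟ s) ∧ adj Δ i j) ∨ adj Θ r s
adj-lex-combine {k} {m} Θ Δ r i s j = cong₂ lexAdj (remQuot-combine {k} {m} r i) (remQuot-combine s j)
  where
  lexAdj : Fin k × Fin m → Fin k × Fin m → Bool
  lexAdj (θ₁ , δ₁) (θ₂ , δ₂) = (does (θ₁ ≟ θ₂) ∧ adj Δ δ₁ δ₂) ∨ adj Θ θ₁ θ₂

module ModularPartition {n} {Γ : Graph n} (vt : VertexTransitive Γ)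
  {_~_ : Rel (Fin n) 0ℓ} (~-isDecEquivalence : IsDecEquivalence _~_)
  (~-invariant : ∀ (g : Aut Γ) {u v} → u ~ v → app g u ~ app g v)
  (~-module : ∀ {u v w} → u ~ v → ¬ u ~ w → adj Γ u w ≡ adj Γ v w)
  {b : Fin n} {m} (e : Fin m → Fin n) (e-injective : Injective _≡_ _≡_ e)
  (e-class : ∀ i → b ~ e i) (e-complete : ∀ {v} → b ~ v → ∃ λ i → e i ≡ v) where

  open IsDecEquivalence ~-isDecEquivalence
    renaming (refl to ~-refl; sym to ~-sym; trans to ~-trans; _≟_ to _~?_)

  adj-module₂ : ∀ {x x′ y y′} → x ~ x′ → y ~ y′ → ¬ x ~ y → adj Γ x y ≡ adj Γ x′ y′
  adj-module₂ {x} {x′} {y} {y′} x~x′ y~y′ x≁y = begin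
    adj Γ x y     ≡⟨ ~-module x~x′ x≁y ⟩
    adj Γ x′ y    ≡⟨ symm Γ x′ y ⟩
    adj Γ y x′    ≡⟨ ~-module y~y′ (λ y~x′ → x≁y (~-trans x~x′ (~-sym y~x′))) ⟩
    adj Γ y′ x′   ≡⟨ symm Γ y′ x′ ⟩
    adj Γ x′ y′   ∎
    where open ≡-Reasoning

  rep : Fin n → Fin n
  rep v = proj₁ (least (v ~?_) (v , ~-refl))

  rep-least : ∀ v → IsLeast (v ~_) (rep v)
  rep-least v = proj₂ (least (v ~?_) (v , ~-refl))

  ~rep : ∀ v → v ~ rep v
  ~rep v = proj₁ (rep-least v)

  rep-cong : ∀ {u v} → u ~ v → rep u ≡ rep v
  rep-cong {u} {v} u~v = least-unique (rep-least u)
    (~-trans u~v (~rep v) , λ j<rep u~j → proj₂ (rep-least v) j<rep (~-trans (~-sym u~v) u~j))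

  IsRep : Fin n → Bool
  IsRep v = ⌊ rep v ≟ v ⌋

  k : ℕ
  k = count IsRep

  representative : Fin k → Fin n
  representative = enumerate IsRep

  rep-representative : ∀ r → rep (representative r) ≡ representative r
  rep-representative r = toWitness (enumerate-sound IsRep r)

  class : Fin n → Fin k
  class v = proj₁ (enumerate-complete IsRep (rep v) (fromWitness (rep-cong (~-sym (~rep v)))))

  representative-class : ∀ v → representative (class v) ≡ rep v
  representative-class v = proj₂ (enumerate-complete IsRep (rep v) (fromWitness (rep-cong (~-sym (~rep v)))))

  class-cong : ∀ {u v} → u ~ v → class u ≡ class v
  class-cong {u} {v} u~v = enumerate-injective IsRep
    (trans (representative-class u) (trans (rep-cong u~v) (sym (representative-class v))))

  class≡⇒~ : ∀ {u v} → class u ≡ class v → u ~ v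
  class≡⇒~ {u} {v} eq = ~-trans (~rep u) (subst (_~ v) rep-v≡rep-u (~-sym (~rep v)))
    where
    rep-v≡rep-u : rep v ≡ rep u
    rep-v≡rep-u = trans (sym (representative-class v)) (trans (cong representative (sym eq)) (representative-class u))

  class-representative : ∀ r → class (representative r) ≡ r
  class-representative r = enumerate-injective IsRep (trans (representative-class _) (rep-representative r))

  Θ : Graph k
  Θ = induced Γ representative

  Δ : Graph m
  Δ = induced Γ e

  act : Aut Γ → Fin k → Fin k
  act h r = class (app h (representative r))

  act-inverse : ∀ h h′ → (∀ x → app h (app h′ x) ≡ x) → ∀ r → act h (act h′ r) ≡ r
  act-inverse h h′ h∘h′ r = begin
    class (app h (representative (class (app h′ (representative r)))))
      ≡⟨ cong (class ∘ app h) (representative-class _) ⟩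
    class (app h (rep (app h′ (representative r))))
      ≡⟨ class-cong (~-invariant h (~rep _)) ⟨
    class (app h (app h′ (representative r)))
      ≡⟨ cong class (h∘h′ _) ⟩
    class (representative r)
      ≡⟨ class-representative r ⟩
    r ∎
    where open ≡-Reasoning

  act-adj : ∀ h r s → adj Θ (act h r) (act h s) ≡ adj Θ r s
  act-adj h r s with r ≟ s
  ... | yes refl = trans (irrefl Θ (act h r)) (sym (irrefl Θ r))
  ... | no  r≢s  = begin
    adj Γ (representative (act h r)) (representative (act h s))
      ≡⟨ cong₂ (adj Γ) (representative-class _) (representative-class _) ⟩
    adj Γ (rep (app h (representative r))) (rep (app h (representative s)))
      ≡⟨ adj-module₂ (~rep _) (~rep _) h·r≁h·s ⟨
    adj Γ (app h (representative r)) (app h (representative s))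
      ≡⟨ adj-app h _ _ ⟩
    adj Γ (representative r) (representative s) ∎
    where
    open ≡-Reasoning
    h·r≁h·s : ¬ app h (representative r) ~ app h (representative s)
    h·r≁h·s h·r~h·s = r≢s (begin
      r                                ≡⟨ class-representative r ⟨
      class (representative r)
        ≡⟨ class-cong (subst₂ _~_ (app⁻¹-app h _) (app⁻¹-app h _) (~-invariant (h ⁻¹ᴬ) h·r~h·s)) ⟩
      class (representative s)         ≡⟨ class-representative s ⟩
      s                                ∎)

  Θ-automorphism : Aut Γ → Aut Θ
  Θ-automorphism h = automorphism (act h) (act (h ⁻¹ᴬ))
    (act-inverse h (h ⁻¹ᴬ) (app-app⁻¹ h)) (act-inverse (h ⁻¹ᴬ) h (app⁻¹-app h)) (act-adj h)

  Θ-vertexTransitive : VertexTransitive Θ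
  Θ-vertexTransitive r s = Θ-automorphism h , trans (cong class h·r≡s) (class-representative s)
    where
    h : Aut Γ
    h = proj₁ (vt (representative r) (representative s))
    h·r≡s : app h (representative r) ≡ representative s
    h·r≡s = proj₂ (vt (representative r) (representative s))

  g : Fin n → Aut Γ
  g v = proj₁ (vt b v)

  g-b : ∀ v → app (g v) b ≡ v
  g-b v = proj₂ (vt b v)

  b~g⁻¹ : ∀ v → b ~ app⁻¹ (g (rep v)) v
  b~g⁻¹ v = subst (_~ app⁻¹ (g (rep v)) v) g⁻¹-rep≡b (~-invariant (g (rep v) ⁻¹ᴬ) (~-sym (~rep v)))
    where
    g⁻¹-rep≡b : app⁻¹ (g (rep v)) (rep v) ≡ b
    g⁻¹-rep≡b = trans (cong (app⁻¹ (g (rep v))) (sym (g-b (rep v)))) (app⁻¹-app (g (rep v)) b)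

  position : Fin n → Fin m
  position v = proj₁ (e-complete (b~g⁻¹ v))

  e-position : ∀ v → e (position v) ≡ app⁻¹ (g (rep v)) v
  e-position v = proj₂ (e-complete (b~g⁻¹ v))

  point : Fin k → Fin m → Fin n
  point r i = app (g (representative r)) (e i)

  point-class-position : ∀ v → point (class v) (position v) ≡ v
  point-class-position v = begin
    app (g (representative (class v))) (e (position v))
      ≡⟨ cong (λ u → app (g u) (e (position v))) (representative-class v) ⟩
    app (g (rep v)) (e (position v))                     ≡⟨ cong (app (g (rep v))) (e-position v) ⟩
    app (g (rep v)) (app⁻¹ (g (rep v)) v)                ≡⟨ app-app⁻¹ (g (rep v)) v ⟩
    v                                                    ∎
    where open ≡-Reasoning

  class-point : ∀ r i → class (point r i) ≡ r
  class-point r i = trans (class-cong (~-sym r~point)) (class-representative r)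
    where
    r~point : representative r ~ point r i
    r~point = subst (_~ point r i) (g-b (representative r)) (~-invariant (g (representative r)) (e-class i))

  position-point : ∀ r i → position (point r i) ≡ i
  position-point r i = e-injective (begin
    e (position (point r i))                        ≡⟨ e-position (point r i) ⟩
    app⁻¹ (g (rep (point r i))) (point r i)         ≡⟨ cong (λ u → app⁻¹ (g u) (point r i)) rep-point ⟩
    app⁻¹ (g (representative r)) (point r i)        ≡⟨ app⁻¹-app (g (representative r)) (e i) ⟩
    e i                                             ∎)
    where
    open ≡-Reasoning
    rep-point : rep (point r i) ≡ representative r
    rep-point = trans (sym (representative-class (point r i))) (cong representative (class-point r i))

  adj-decomposition : ∀ x y →
    adj Γ x y ≡ (does (class x ≟ class y) ∧ adj Δ (position x) (position y)) ∨ adj Θ (class x) (class y)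
  adj-decomposition x y with class x ≟ class y
  ... | no  cx≢cy = trans (adj-module₂ (~rep x) (~rep y) (cx≢cy ∘ class-cong))
                          (sym (cong₂ (adj Γ) (representative-class x) (representative-class y)))
  ... | yes cx≡cy = sym (begin
    adj Δ (position x) (position y) ∨ adj Θ (class x) (class y)
      ≡⟨ cong (adj Δ (position x) (position y) ∨_)
              (trans (cong (adj Θ (class x)) (sym cx≡cy)) (irrefl Θ (class x))) ⟩
    adj Δ (position x) (position y) ∨ false
      ≡⟨ ∨-identityʳ _ ⟩
    adj Γ (e (position x)) (e (position y))
      ≡⟨ cong₂ (adj Γ) (e-position x)
               (trans (e-position y) (cong (λ u → app⁻¹ (g u) y) (sym (rep-cong (class≡⇒~ cx≡cy))))) ⟩
    adj Γ (app⁻¹ (g (rep x)) x) (app⁻¹ (g (rep x)) y)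
      ≡⟨ adj-app (g (rep x) ⁻¹ᴬ) x y ⟩
    adj Γ x y ∎)
    where open ≡-Reasoning

  Γ≅Θ[Δ] : Γ ≅ lex Θ Δ
  Γ≅Θ[Δ] = record
    { bij      = mk↔ₛ′ (λ v → combine (class v) (position v)) (uncurry point ∘ remQuot m)
        (λ u → trans (cong₂ combine (class-point _ _) (position-point _ _)) (combine-remQuot {k} m u))
        (λ v → trans (cong (uncurry point) (remQuot-combine (class v) (position v))) (point-class-position v))
    ; preserve = λ x y → trans (adj-lex-combine Θ Δ (class x) (position x) (class y) (position y))
                               (sym (adj-decomposition x y))
    }

module Periodic {p} .{{_ : NonZero p}} (M : ℕ → Bool) (M-periodic : ∀ a → M (a + p) ≡ M a) where

  Closed : ℕ → Set
  Closed d = ∀ a → T (M a) → T (M (a + d))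

  periodic-* : ∀ j a → M (a + j * p) ≡ M a
  periodic-* zero    a = cong M (+-identityʳ a)
  periodic-* (suc j) a = begin
    M (a + (p + j * p))   ≡⟨ cong M (trans (cong (a +_) (+-comm p (j * p))) (sym (+-assoc a (j * p) p))) ⟩
    M (a + j * p + p)     ≡⟨ M-periodic (a + j * p) ⟩
    M (a + j * p)         ≡⟨ periodic-* j a ⟩
    M a                   ∎
    where open ≡-Reasoning

  closed-* : ∀ {d} → Closed d → ∀ j → Closed (j * d)
  closed-* closed zero    a Ma = subst (T ∘ M) (sym (+-identityʳ a)) Ma
  closed-* {d} closed (suc j) a Ma = subst (T ∘ M) (+-assoc a d (j * d)) (closed-* closed j (a + d) (closed a Ma))

  closed⇒co-closed : ∀ {d} → Closed d → ∀ a → T (M (a + d)) → T (M a)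
  closed⇒co-closed {d} closed a Ma+d = subst T (periodic-* d a)
    (subst (T ∘ M) wrap (closed-* closed (pred p) (a + d) Ma+d))
    where
    open ≡-Reasoning
    wrap : a + d + pred p * d ≡ a + d * p
    wrap = begin
      a + d + pred p * d     ≡⟨ +-assoc a d (pred p * d) ⟩
      a + suc (pred p) * d   ≡⟨ cong (λ m → a + m * d) (suc-pred p) ⟩
      a + p * d              ≡⟨ cong (a +_) (*-comm p d) ⟩
      a + d * p              ∎

  closed-1⇒full : Closed 1 → ∀ a b → T (M a) → T (M b)
  closed-1⇒full closed-1 a b Ma = closed b 0 (closed⇒co-closed (closed a) 0 Ma)
    where
    closed : ∀ t → Closed t
    closed t x Mx = subst (T ∘ M) (cong (x +_) (*-identityʳ t)) (closed-* closed-1 t x Mx)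

  shift-closed⇒full : Prime p → ∀ {s} → 0 < s → s < p → Closed s → ∀ a b → T (M a) → T (M b)
  shift-closed⇒full p-prime {s} 0<s s<p closed = closed-1⇒full closed-1
    where
    instance _ = >-nonZero 0<s
    closed-1 : Closed 1
    closed-1 a Ma with coprime-Bézout (coprime-sym (prime⇒coprime p-prime s<p))
    -- Bézout: x s ≡ ±1 (mod p).
    ... | Bézout.+- x y 1+yp≡xs = subst T (periodic-* y (a + 1))
      (subst (T ∘ M) (trans (cong (a +_) (sym 1+yp≡xs)) (sym (+-assoc a 1 (y * p)))) (closed-* closed x a Ma))
    ... | Bézout.-+ x y 1+xs≡yp = closed⇒co-closed (closed-* closed x) (a + 1)
      (subst (T ∘ M) (trans (cong (a +_) (sym 1+xs≡yp)) (sym (+-assoc a 1 (x * s)))) (subst T (sym (periodic-* y a)) Ma))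

cut-uniform : ∀ {p} → Prime p → (f : ℕ → ℕ → Bool) → (∀ a b → f (suc a) (suc b) ≡ f a b) →
  (M : ℕ → Bool) → (∀ a → M (a + p) ≡ M a) → ∀ {a₀ b₀} → T (M a₀) → ¬ T (M b₀) →
  ∀ {β} → (∀ a b → T (M a) → ¬ T (M b) → f a b ≡ β) → ∀ s → 0 < s → s < p → f 0 s ≡ β
cut-uniform {p} p-prime f f-suc M M-periodic {a₀} {b₀} Ma₀ ¬Mb₀ {β} across s 0<s s<p with f 0 s Bool.≟ β
... | yes f0s≡β = f0s≡β
... | no  f0s≢β = contradiction (shift-closed⇒full p-prime 0<s s<p closed a₀ b₀ Ma₀) ¬Mb₀
  where
  instance _ = prime⇒nonZero p-prime
  open Periodic M M-periodic
  f-+ : ∀ t x y → f (t + x) (t + y) ≡ f x y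
  f-+ zero    x y = refl
  f-+ (suc t) x y = trans (f-suc (t + x) (t + y)) (f-+ t x y)
  closed : Closed s
  closed a Ma with T? (M (a + s))
  ... | yes Ma+s = Ma+s
  ... | no ¬Ma+s = contradiction (trans (sym f-a-shift) (across a (a + s) Ma ¬Ma+s)) f0s≢β
    where
    f-a-shift : f a (a + s) ≡ f 0 s
    f-a-shift = trans (cong (λ x → f x (a + s)) (sym (+-identityʳ a))) (f-+ a 0 s)

LexDecomposition : ∀ {n} → Graph n → ℕ → Set
LexDecomposition Γ p = Σ ℕ λ k → Σ ℕ λ m → Σ (Graph k) λ Θ → Σ (Graph m) λ Δ →
  VertexTransitive Θ × ((2 ≤ m × (IsComplete Δ ⊎ IsEdgeless Δ)) ⊎ (m ≡ p × IsCirculant Δ)) × (Γ ≅ lex Θ Δ)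

module Twins {n} {Γ : Graph n} (vt : VertexTransitive Γ) {r} (σ : Aut Γ)
  (cycle : IsCycle {Γ = Γ} (suc (suc r)) σ) {β : Bool} (uniform : Cycle.Uniform σ cycle β) where

  open Cycle σ cycle

  -- The closed neighbourhood of u when β = true, the open one when β = false.
  N : Fin n → Fin n → Bool
  N u z = adj Γ u z ∨ (β ∧ does (u ≟ z))

  N-≢ : ∀ {u z} → u ≢ z → N u z ≡ adj Γ u z
  N-≢ {u} {z} u≢z with u ≟ z
  ... | yes u≡z = contradiction u≡z u≢z
  ... | no  _   = trans (cong (adj Γ u z ∨_) (∧-zeroʳ β)) (∨-identityʳ _)

  N-self : ∀ u → N u u ≡ β
  N-self u with u ≟ u
  ... | yes _   = trans (cong (_∨ (β ∧ true)) (irrefl Γ u)) (∧-identityʳ β)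
  ... | no  u≢u = contradiction refl u≢u

  N-app : ∀ (h : Aut Γ) u z → N (app h u) z ≡ N u (app⁻¹ h z)
  N-app h u z = cong₂ _∨_ (adj-appˡ h u z) (cong (β ∧_) eq-h)
    where
    eq-h : does (app h u ≟ z) ≡ does (u ≟ app⁻¹ h z)
    eq-h with app h u ≟ z | u ≟ app⁻¹ h z
    ... | yes _    | yes _    = refl
    ... | no  _    | no  _    = refl
    ... | yes hu≡z | no  u≢h⁻¹z = contradiction (trans (sym (app⁻¹-app h u)) (cong (app⁻¹ h) hu≡z)) u≢h⁻¹z
    ... | no  hu≢z | yes u≡h⁻¹z = contradiction (trans (cong (app h) u≡h⁻¹z) (app-app⁻¹ h z)) hu≢z

  _≈_ : Rel (Fin n) 0ℓ
  u ≈ v = ∀ z → N u z ≡ N v z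

  ≈-isDecEquivalence : IsDecEquivalence _≈_
  ≈-isDecEquivalence = record
    { isEquivalence = record
      { refl  = λ _ → refl
      ; sym   = λ u≈v z → sym (u≈v z)
      ; trans = λ u≈v v≈w z → trans (u≈v z) (v≈w z)
      }
    ; _≟_ = λ u v → all? λ z → N u z Bool.≟ N v z
    }

  ≈-invariant : ∀ (h : Aut Γ) {u v} → u ≈ v → app h u ≈ app h v
  ≈-invariant h {u} {v} u≈v z = trans (N-app h u z) (trans (u≈v _) (sym (N-app h v z)))

  ≈-module : ∀ {u v w} → u ≈ v → ¬ u ≈ w → adj Γ u w ≡ adj Γ v w
  ≈-module {u} {v} {w} u≈v u≉w = trans (sym (N-≢ u≢w)) (trans (u≈v w) (N-≢ v≢w))
    where
    u≢w : u ≢ w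
    u≢w refl = u≉w λ _ → refl
    v≢w : v ≢ w
    v≢w refl = u≉w u≈v

  cycle-twins : ∀ i j → c i ≈ c j
  cycle-twins i j z with onCycle? z
  ... | yes (l , refl) = trans (N-cycle i) (sym (N-cycle j))
    where
    N-cycle : ∀ i → N (c i) (c l) ≡ β
    N-cycle i with i ≟ l
    ... | yes refl = N-self (c i)
    ... | no  i≢l  = trans (N-≢ (i≢l ∘ c-injective i l)) (uniform-pairs uniform i l i≢l)
  ... | no  z∉C = begin
    N (c i) z       ≡⟨ N-≢ (λ cᵢ≡z → z∉C (i , cᵢ≡z)) ⟩
    adj Γ (c i) z   ≡⟨ symm Γ (c i) z ⟩
    adj Γ z (c i)   ≡⟨ off-cycle-uniform z∉C i j ⟩
    adj Γ z (c j)   ≡⟨ symm Γ z (c j) ⟩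
    adj Γ (c j) z   ≡⟨ N-≢ (λ cⱼ≡z → z∉C (j , cⱼ≡z)) ⟨
    N (c j) z       ∎
    where open ≡-Reasoning

  twin₀ : Fin n → Bool
  twin₀ v = ⌊ IsDecEquivalence._≟_ ≈-isDecEquivalence (c zero) v ⌋

  m : ℕ
  m = count twin₀

  e : Fin m → Fin n
  e = enumerate twin₀

  open ModularPartition vt ≈-isDecEquivalence ≈-invariant ≈-module e (enumerate-injective twin₀)
    (toWitness ∘ enumerate-sound twin₀) (λ {v} c₀≈v → enumerate-complete twin₀ v (fromWitness c₀≈v))
    using (k; Θ; Δ; Θ-vertexTransitive; Γ≅Θ[Δ])

  Δ-uniform : ∀ i j → i ≢ j → adj Δ i j ≡ β
  Δ-uniform i j i≢j = begin
    adj Γ (e i) (e j)   ≡⟨ N-≢ (i≢j ∘ enumerate-injective twin₀) ⟨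
    N (e i) (e j)       ≡⟨ eᵢ≈eⱼ (e j) ⟩
    N (e j) (e j)       ≡⟨ N-self (e j) ⟩
    β                   ∎
    where
    open ≡-Reasoning
    eᵢ≈eⱼ : e i ≈ e j
    eᵢ≈eⱼ z = trans (sym (toWitness (enumerate-sound twin₀ i) z)) (toWitness (enumerate-sound twin₀ j) z)

  Δ-shape : IsComplete Δ ⊎ IsEdgeless Δ
  Δ-shape = shape β refl
    where
    shape : ∀ b → β ≡ b → IsComplete Δ ⊎ IsEdgeless Δ
    shape true  β≡true  = inj₁ λ i j i≢j → trans (Δ-uniform i j i≢j) β≡true
    shape false β≡false = inj₂ edgeless
      where
      edgeless : IsEdgeless Δ
      edgeless i j with i ≟ j
      ... | yes refl = irrefl Δ i
      ... | no  i≢j  = trans (Δ-uniform i j i≢j) β≡false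

  2≤m : 2 ≤ m
  2≤m = distinct⇒2≤ {i = index zero} {index (suc zero)}
    (λ eq → 0≢1 (c-injective _ _ (trans (sym (e-index zero)) (trans (cong e eq) (e-index (suc zero))))))
    where
    index : Fin p → Fin m
    index i = proj₁ (enumerate-complete twin₀ (c i) (fromWitness (cycle-twins zero i)))
    e-index : ∀ i → e (index i) ≡ c i
    e-index i = proj₂ (enumerate-complete twin₀ (c i) (fromWitness (cycle-twins zero i)))
    0≢1 : zero ≢ suc zero
    0≢1 ()

  decomposition : LexDecomposition Γ p
  decomposition = k , m , Θ , Δ , Θ-vertexTransitive , inj₁ (2≤m , Δ-shape) , Γ≅Θ[Δ]

module Blocks {n} {Γ : Graph n} (vt : VertexTransitive Γ) {q} (σ : Aut Γ)
  (cycle : IsCycle {Γ = Γ} (suc q) σ) (p-prime : Prime (suc q))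
  (nonuniform : ∀ β → ¬ Cycle.Uniform σ cycle β) where

  open Cycle σ cycle

  no-straddle : ∀ (h : Aut Γ) {i₀ j₀ i₁ j*} → app h (c i₀) ≡ c j₀ → ¬ OnCycle (app h (c i₁)) →
                (∀ i → app h (c i) ≢ c j*) → ⊥
  -- Vertices off C see C uniformly, and c j*, being off h·C (the cycle of h σ h⁻¹), sees h·C
  -- uniformly; so adjacency is constant across the cut M, and cut-uniform makes C uniform.
  no-straddle h {i₀} {j₀} {i₁} {j*} h·cᵢ₀≡cⱼ₀ h·cᵢ₁∉C c*∉h·C = nonuniform β uniform
    where
    open ≡-Reasoning
    d : ℕ → Fin n
    d a = app h (c̃ a)
    d-toℕ : ∀ i → d (toℕ i) ≡ app h (c i)
    d-toℕ i = cong (app h) (c̃-toℕ i)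
    f : ℕ → ℕ → Bool
    f a b = adj Γ (d a) (d b)
    f-suc : ∀ a b → f (suc a) (suc b) ≡ f a b
    f-suc a b = begin
      adj Γ (d (suc a)) (d (suc b))                   ≡⟨ adj-app h _ _ ⟩
      adj Γ (c̃ (suc a)) (c̃ (suc b))                   ≡⟨ cong₂ (adj Γ) (σ-c̃ a) (σ-c̃ b) ⟨
      adj Γ (app σ (c̃ a)) (app σ (c̃ b))               ≡⟨ adj-app σ _ _ ⟩
      adj Γ (c̃ a) (c̃ b)                               ≡⟨ adj-app h _ _ ⟨
      adj Γ (d a) (d b)                               ∎
    M : ℕ → Bool
    M a = ⌊ onCycle? (d a) ⌋
    M-periodic : ∀ a → M (a + p) ≡ M a
    M-periodic a = cong (λ z → ⌊ onCycle? (app h z) ⌋) (c̃-periodic a)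
    a₀ b₀ : ℕ
    a₀ = toℕ i₀
    b₀ = toℕ i₁
    da₀≡cⱼ₀ : d a₀ ≡ c j₀
    da₀≡cⱼ₀ = trans (d-toℕ i₀) h·cᵢ₀≡cⱼ₀
    db₀∉C : ¬ OnCycle (d b₀)
    db₀∉C = h·cᵢ₁∉C ∘ subst OnCycle (d-toℕ i₁)
    β : Bool
    β = f a₀ b₀
    c*-sees-h·C-uniformly : ∀ a a′ → adj Γ (c j*) (d a) ≡ adj Γ (c j*) (d a′)
    c*-sees-h·C-uniformly a a′ = begin
      adj Γ (c j*) (d a)                 ≡⟨ adj-app⁻¹ˡ h (c j*) (c̃ a) ⟨
      adj Γ (app⁻¹ h (c j*)) (c̃ a)       ≡⟨ off-cycle-uniform h⁻¹c*∉C (a mod p) (a′ mod p) ⟩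
      adj Γ (app⁻¹ h (c j*)) (c̃ a′)      ≡⟨ adj-app⁻¹ˡ h (c j*) (c̃ a′) ⟩
      adj Γ (c j*) (d a′)                ∎
      where
      h⁻¹c*∉C : ¬ OnCycle (app⁻¹ h (c j*))
      h⁻¹c*∉C (i , cᵢ≡h⁻¹c*) = c*∉h·C i (trans (cong (app h) cᵢ≡h⁻¹c*) (app-app⁻¹ h (c j*)))
    across : ∀ a b → T (M a) → ¬ T (M b) → f a b ≡ β
    across a b Ma ¬Mb = begin
      adj Γ (d a) (d b)       ≡⟨ symm Γ (d a) (d b) ⟩
      adj Γ (d b) (d a)       ≡⟨ cong (adj Γ (d b)) cₐ≡da ⟨
      adj Γ (d b) (c jₐ)      ≡⟨ off-cycle-uniform db∉C jₐ j* ⟩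
      adj Γ (d b) (c j*)      ≡⟨ symm Γ (d b) (c j*) ⟩
      adj Γ (c j*) (d b)      ≡⟨ c*-sees-h·C-uniformly b b₀ ⟩
      adj Γ (c j*) (d b₀)     ≡⟨ symm Γ (c j*) (d b₀) ⟩
      adj Γ (d b₀) (c j*)     ≡⟨ off-cycle-uniform db₀∉C j* j₀ ⟩
      adj Γ (d b₀) (c j₀)     ≡⟨ cong (adj Γ (d b₀)) da₀≡cⱼ₀ ⟨
      adj Γ (d b₀) (d a₀)     ≡⟨ symm Γ (d b₀) (d a₀) ⟩
      adj Γ (d a₀) (d b₀)     ∎
      where
      jₐ : Fin p
      jₐ = proj₁ (toWitness Ma)
      cₐ≡da : c jₐ ≡ d a
      cₐ≡da = proj₂ (toWitness Ma)
      db∉C : ¬ OnCycle (d b)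
      db∉C = ¬Mb ∘ fromWitness
    uniform : Uniform β
    uniform s s≢0 = trans (sym (trans (adj-app h _ _) (cong (adj Γ (c zero)) (c̃-toℕ s))))
      (cut-uniform p-prime f f-suc M M-periodic {a₀} {b₀} (fromWitness (j₀ , sym da₀≡cⱼ₀)) (db₀∉C ∘ toWitness)
        across (toℕ s) (nonzero s s≢0) (toℕ<n s))
      where
      nonzero : ∀ s → s ≢ zero → 0 < toℕ s
      nonzero zero    s≢0 = contradiction refl s≢0
      nonzero (suc s) _   = s≤s z≤n

  block : ∀ (h : Aut Γ) {i₀ j₀} → app h (c i₀) ≡ c j₀ → ∀ i → OnCycle (app h (c i))
  block h h·cᵢ₀≡cⱼ₀ i with onCycle? (app h (c i))
  ... | yes h·cᵢ∈C = h·cᵢ∈C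
  ... | no  h·cᵢ∉C with all? (λ j → any? (λ i′ → app h (c i′) ≟ c j))
  ...   | yes covers = let j , preⱼ≡i = injective⇒surjective pre pre-injective i in
                       j , sym (subst (λ i′ → app h (c i′) ≡ c j) preⱼ≡i (proj₂ (covers j)))
    where
    pre : Fin p → Fin p
    pre j = proj₁ (covers j)
    pre-injective : ∀ {j j′} → pre j ≡ pre j′ → j ≡ j′
    pre-injective {j} {j′} eq = c-injective j j′
      (trans (sym (proj₂ (covers j))) (trans (cong (app h ∘ c) eq) (proj₂ (covers j′))))
  ...   | no  ¬covers with ¬∀⟶∃¬ p _ (λ j → any? (λ i′ → app h (c i′) ≟ c j)) ¬covers
  ...     | _ , c*∉h·C = ⊥-elim (no-straddle h h·cᵢ₀≡cⱼ₀ h·cᵢ∉C (λ i′ h·cᵢ′≡c* → c*∉h·C (i′ , h·cᵢ′≡c*)))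

  translates-meet⇒⊆ : ∀ (g h : Aut Γ) {i₀ j₀} → app g (c i₀) ≡ app h (c j₀) →
                      ∀ i → ∃ λ j → app g (c i) ≡ app h (c j)
  translates-meet⇒⊆ g h {i₀} {j₀} g·cᵢ₀≡h·cⱼ₀ i =
    let j , cⱼ≡h⁻¹g·cᵢ = block (h ⁻¹ᴬ ∘ᴬ g) (trans (cong (app⁻¹ h) g·cᵢ₀≡h·cⱼ₀) (app⁻¹-app h (c j₀))) i
    in j , sym (trans (cong (app h) cⱼ≡h⁻¹g·cᵢ) (app-app⁻¹ h _))

  g : Fin n → Aut Γ
  g u = proj₁ (vt (c zero) u)

  g-c₀ : ∀ u → app (g u) (c zero) ≡ u
  g-c₀ u = proj₂ (vt (c zero) u)

  _~_ : Rel (Fin n) 0ℓ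
  u ~ v = ∃ λ i → app (g u) (c i) ≡ v

  ~-isDecEquivalence : IsDecEquivalence _~_
  ~-isDecEquivalence = record
    { isEquivalence = record { refl = zero , g-c₀ _ ; sym = ~-sym ; trans = ~-trans }
    ; _≟_ = λ u v → any? λ i → app (g u) (c i) ≟ v
    }
    where
    ~-sym : ∀ {u v} → u ~ v → v ~ u
    ~-sym {u} {v} (i , g·cᵢ≡v) =
      let j , eq = translates-meet⇒⊆ (g u) (g v) (trans g·cᵢ≡v (sym (g-c₀ v))) zero in j , trans (sym eq) (g-c₀ u)
    ~-trans : ∀ {u v w} → u ~ v → v ~ w → u ~ w
    ~-trans {u} {v} {w} (i , g·cᵢ≡v) (j , g·cⱼ≡w) =
      let j′ , eq = translates-meet⇒⊆ (g v) (g u) (trans (g-c₀ v) (sym g·cᵢ≡v)) j in j′ , trans (sym eq) g·cⱼ≡w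

  ~-invariant : ∀ (h : Aut Γ) {u v} → u ~ v → app h u ~ app h v
  ~-invariant h {u} {v} (i , g·cᵢ≡v) =
    let j , eq = translates-meet⇒⊆ (h ∘ᴬ g u) (g (app h u))
                   (trans (cong (app h) (g-c₀ u)) (sym (g-c₀ (app h u)))) i
    in j , trans (sym eq) (cong (app h) g·cᵢ≡v)

  ~-module : ∀ {u v w} → u ~ v → ¬ u ~ w → adj Γ u w ≡ adj Γ v w
  ~-module {u} {v} {w} (i , g·cᵢ≡v) u≁w = begin
    adj Γ u w                                 ≡⟨ cong (λ x → adj Γ x w) (g-c₀ u) ⟨
    adj Γ (app (g u) (c zero)) w              ≡⟨ adj-appˡ (g u) (c zero) w ⟩
    adj Γ (c zero) (app⁻¹ (g u) w)            ≡⟨ symm Γ _ _ ⟩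
    adj Γ (app⁻¹ (g u) w) (c zero)            ≡⟨ off-cycle-uniform g⁻¹w∉C zero i ⟩
    adj Γ (app⁻¹ (g u) w) (c i)               ≡⟨ symm Γ _ _ ⟩
    adj Γ (c i) (app⁻¹ (g u) w)               ≡⟨ adj-appˡ (g u) (c i) w ⟨
    adj Γ (app (g u) (c i)) w                 ≡⟨ cong (λ x → adj Γ x w) g·cᵢ≡v ⟩
    adj Γ v w                                 ∎
    where
    open ≡-Reasoning
    g⁻¹w∉C : ¬ OnCycle (app⁻¹ (g u) w)
    g⁻¹w∉C (j , cⱼ≡g⁻¹w) = u≁w (j , trans (cong (app (g u)) cⱼ≡g⁻¹w) (app-app⁻¹ (g u) w))

  -- The ~-class of c zero is C as a set, but it is enumerated through g (c zero).
  e : Fin p → Fin n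
  e i = app (g (c zero)) (c i)

  open ModularPartition vt ~-isDecEquivalence ~-invariant ~-module e
    (λ eq → c-injective _ _ (app-injective (g (c zero)) eq)) (λ i → i , refl) (λ c₀~v → c₀~v)
    using (k; Θ; Δ; Θ-vertexTransitive; Γ≅Θ[Δ])

  Δ-circulant : IsCirculant Δ
  Δ-circulant s i j = begin
    adj Γ (e (shift s i)) (e (shift s j))          ≡⟨ adj-app (g (c zero)) _ _ ⟩
    adj Γ (c̃ (toℕ i + toℕ s)) (c̃ (toℕ j + toℕ s))  ≡⟨ adj-c̃-+ (toℕ i) (toℕ j) (toℕ s) ⟩
    adj Γ (c̃ (toℕ i)) (c̃ (toℕ j))                  ≡⟨ cong₂ (adj Γ) (c̃-toℕ i) (c̃-toℕ j) ⟩
    adj Γ (c i) (c j)                              ≡⟨ adj-app (g (c zero)) _ _ ⟨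
    adj Γ (e i) (e j)                              ∎
    where open ≡-Reasoning

  decomposition : LexDecomposition Γ p
  decomposition = k , p , Θ , Δ , Θ-vertexTransitive , inj₂ (refl , Δ-circulant) , Γ≅Θ[Δ]

prime-cycle⇒decomposition : ∀ {n} {Γ : Graph n} {p} → Prime p → VertexTransitive Γ →
  (σ : Aut Γ) → IsCycle {Γ = Γ} p σ → LexDecomposition Γ p
prime-cycle⇒decomposition {Γ = Γ} {p = suc (suc r)} p-prime vt σ cycle
  with all? (λ s → ¬? (s ≟ zero) →-dec (adj Γ (c zero) (c s) Bool.≟ adj Γ (c zero) (c (suc zero))))
  where open Cycle σ cycle
... | yes uniform  = Twins.decomposition vt σ cycle uniform
... | no ¬uniform = Blocks.decomposition vt σ cycle p-prime
  λ β uniform → ¬uniform λ s s≢0 → trans (uniform s s≢0) (sym (uniform (suc zero) λ ()))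

corollary3p7 : (p : ℕ) → Prime p → 5 ≤ p →
    ((n : ℕ) (Γ : Graph n) → VertexTransitive Γ → ¬ HasMotion Γ p)
    × ((n : ℕ) (Γ : Graph n) → VertexTransitive Γ →
        Σ (Aut Γ) (λ σ → IsCycle p σ) →
        Σ ℕ λ k → Σ ℕ λ m → Σ (Graph k) λ Θ → Σ (Graph m) λ Δ →
          VertexTransitive Θ
          × ((2 ≤ m × (IsComplete Δ ⊎ IsEdgeless Δ)) ⊎ (m ≡ p × IsCirculant Δ))
          × (Γ ≅ lex Θ Δ))
corollary3p7 p p-prime 5≤p =
  (λ n Γ _ → ¬HasMotion-oddPrime p-prime p-odd) ,
  (λ n Γ vt (σ , cycle) → prime-cycle⇒decomposition p-prime vt σ cycle)
  where
  p-odd : ¬ 2 ∣ p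
  p-odd 2∣p with prime⇒irreducible p-prime 2∣p
  ... | inj₁ ()
  ... | inj₂ 2≡p = case subst (5 ≤_) (sym 2≡p) 5≤p of λ { (s≤s (s≤s ())) }
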